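{- Let $\mathcal{L}=(L,\leq)$ be a finite congruence-uniform lattice. Then $(\mathrm{Nex}(\mathcal{L}),\leq)$ is an induced subposet of the core label order $\mathrm{CLO}(\mathcal{L})$; that is, for all $x,y\in\mathrm{Nex}(\mathcal{L})$ we have $x\leq y$ if and only if $\Psi(x)\subseteq\Psi(y)$.
   Context: For a finite lattice $\mathcal{L}=(L,\leq)$, $\mathcal{J}(\mathcal{L})$ denotes the set of join-irreducible elements; each $j\in\mathcal{J}(\mathcal{L})$ has a unique lower cover $j_*$. For a cover relation $u\lessdot v$, $\mathrm{cg}(u,v)$ is the finest lattice congruence in which $u,v$ are equivalent, and $\mathrm{cg}(j)=\mathrm{cg}(j_*,j)$; the join-irreducible elements of the congruence lattice are exactly the $\mathrm{cg}(j)$. A finite lattice is congruence-uniform if $j\mapsto\mathrm{cg}(j)$ is a bijection from $\mathcal{J}(\mathcal{L})$ onto the join-irreducible congruences, for both $\mathcal{L}$ and its dual. For a cover $u\lessdot v$, $j_{\mathrm{cg}(u,v)}$ denotes the unique $j\in\mathcal{J}(\mathcal{L})$ with $\mathrm{cg}(j)=\mathrm{cg}(u,v)$. The nucleus of $x$ is $x_\downarrow=\bigwedge\{y\mid y\lessdot x\}$; the core label set is $\Psi(x)=\{j_{\mathrm{cg}(u,v)}\mid x_\downarrow\le u\lessdot v\le x\}$ (empty for $x=\hat0$). The core label order is $\mathrm{CLO}(\mathcal{L})=(L,\sqsubseteq)$ with $x\sqsubseteq y$ iff $\Psi(x)\subseteq\Psi(y)$. $\Gamma(x)$ is the canonical join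 representation of $x$ (the irredundant join representation of $x$ that refines every other irredundant join representation; it exists in congruence-uniform lattices). $\mathrm{Atoms}(\mathcal{L})$ is the set of elements covering $\hat0$, and $\mathrm{Nex}(\mathcal{L})=\{x\in L\mid\Gamma(x)\subseteq\mathrm{Atoms}(\mathcal{L})\}$. -}

module Defs where

open import Level using (0ℓ)
open import Data.Nat using (ℕ)
open import Data.Fin using (Fin)
open import Data.Product using (Σ; ∃; ∃-syntax; _×_; _,_)
open import Data.Sum using (_⊎_)
open import Relation.Nullary using (¬_)
open import Relation.Binary.Core using (Rel)
open import Relation.Binary.Structures using (IsEquivalence)
open import Relation.Binary.PropositionalEquality using (_≡_; _≢_)
open import Relation.Binary.Lattice.Structures using (IsBoundedLattice)
open import Function.Bundles using (_↔_)

record FiniteLattice : Set₁ where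
  field
    Carrier : Set
    _≤_ : Rel Carrier 0ℓ
    _∨_ : Carrier → Carrier → Carrier
    _∧_ : Carrier → Carrier → Carrier
    ⊤ : Carrier
    ⊥ : Carrier
    isBoundedLattice : IsBoundedLattice _≡_ _≤_ _∨_ _∧_ ⊤ ⊥
    size : ℕ
    enum : Carrier ↔ Fin size

module LatticeNotions (𝓛 : FiniteLattice) where
  open FiniteLattice 𝓛

  _<_ : Carrier → Carrier → Set
  x < y = x ≤ y × x ≢ y

  _⋖_ : Carrier → Carrier → Set
  u ⋖ v = u < v × (∀ z → u ≤ z → z ≤ v → (z ≡ u) ⊎ (z ≡ v))

  IsJoinIrreducible : Carrier → Set
  IsJoinIrreducible j = j ≢ ⊥ × (∀ a b → (a ∨ b) ≡ j → (a ≡ j) ⊎ (b ≡ j))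

  IsMeetIrreducible : Carrier → Set
  IsMeetIrreducible m = m ≢ ⊤ × (∀ a b → (a ∧ b) ≡ m → (a ≡ m) ⊎ (b ≡ m))

  IsAtom : Carrier → Set
  IsAtom a = ⊥ ⋖ a

  IsCongruence : Rel Carrier 0ℓ → Set
  IsCongruence θ =
    IsEquivalence θ
    × (∀ a b c d → θ a b → θ c d → θ (a ∨ c) (b ∨ d))
    × (∀ a b c d → θ a b → θ c d → θ (a ∧ c) (b ∧ d))

  cg : Carrier → Carrier → Carrier → Carrier → Set₁
  cg u v x y = (θ : Rel Carrier 0ℓ) → IsCongruence θ → θ u v → θ x y

  SameRel : (Carrier → Carrier → Set₁) → (Carrier → Carrier → Set₁) → Set₁
  SameRel R S = ∀ x y → (R x y → S x y) × (S x y → R x y)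

  -- Congruence uniformity: j ↦ cg(j_*, j) is injective on J(L), and
  -- dually m ↦ cg(m, m^*) is injective on M(L).  (Surjectivity onto the
  -- join-irreducible congruences holds in every finite lattice.)
  CongruenceUniform : Set₁
  CongruenceUniform =
    (∀ j j' c c' → IsJoinIrreducible j → IsJoinIrreducible j'
       → c ⋖ j → c' ⋖ j' → SameRel (cg c j) (cg c' j') → j ≡ j')
    × (∀ m m' c c' → IsMeetIrreducible m → IsMeetIrreducible m'
       → m ⋖ c → m' ⋖ c' → SameRel (cg m c) (cg m' c') → m ≡ m')

  IsNucleus : Carrier → Carrier → Set
  IsNucleus x n =
    (∀ y → y ⋖ x → n ≤ y) × (∀ z → (∀ y → y ⋖ x → z ≤ y) → z ≤ n)

  _∈Ψ_ : Carrier → Carrier → Set₁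
  j ∈Ψ x = IsJoinIrreducible j × ∃[ c ] (c ⋖ j × ∃[ u ] ∃[ v ] ∃[ n ]
             (IsNucleus x n × n ≤ u × u ⋖ v × v ≤ x × SameRel (cg c j) (cg u v)))

  _⊆Ψ_ : Carrier → Carrier → Set₁
  x ⊆Ψ y = ∀ j → j ∈Ψ x → j ∈Ψ y

  Subset : Set₁
  Subset = Carrier → Set

  _⊆_ : Subset → Subset → Set
  A ⊆ B = ∀ a → A a → B a

  IsJoinOf : Subset → Carrier → Set
  IsJoinOf A x = (∀ a → A a → a ≤ x) × (∀ z → (∀ a → A a → a ≤ z) → x ≤ z)

  IsIrredundantJoinRep : Subset → Carrier → Set₁
  IsIrredundantJoinRep A x =
    IsJoinOf A x
    × (∀ (A' : Subset) → A' ⊆ A → (∃[ a ] (A a × ¬ A' a)) → ¬ IsJoinOf A' x)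

  Refines : Subset → Subset → Set
  Refines A B = ∀ a → A a → ∃[ b ] (B b × a ≤ b)

  IsCanonicalJoinRep : Subset → Carrier → Set₁
  IsCanonicalJoinRep A x =
    IsIrredundantJoinRep A x × (∀ B → IsIrredundantJoinRep B x → Refines A B)

  InNex : Carrier → Set₁
  InNex x = ∃[ A ] (IsCanonicalJoinRep A x × (∀ a → A a → IsAtom a))

-- In a congruence-uniform lattice a cover p ⋖ q determines, through cg(p,q) alone,
-- the meet-irreducible element m that is maximal among the elements above p and not
-- above q.  For an atom b this m is κ(b), the largest element not above b, and an
-- atom a labelling a cover u ⋖ v must lie below v: otherwise v ≤ κ(a), yet κ(a) is
-- also the meet-irreducible determined by u ⋖ v, which is not above v.
--
-- If x = ⋁A with A an irredundant set of atoms and x ≠ 0, then x_↓ = 0: an atom b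
-- below every lower cover of x lies in A (else A ≤ κ(b)), but no joinand of an
-- irredundant representation lies below every lower cover.  So Ψ(x) collects the
-- labels of all covers below x, which is monotone in x.  Conversely each a ∈ A labels
-- a lower cover u ⋖ x with a ≰ u, so A ⊆ Ψ(x), and every atom in Ψ(y) is below y.
module Submission where

open import Defs
open import Level using (0ℓ)
import Data.Fin.Properties as Fin
open import Data.List using (List; []; _∷_; map; allFin)
open import Data.List.Membership.Propositional using (_∈_)
open import Data.List.Membership.Propositional.Properties using (∈-map⁺; ∈-allFin)
open import Data.List.Relation.Unary.Any using (here; there)
open import Data.Product using (∃-syntax; _×_; _,_; proj₁; proj₂)
open import Data.Sum using (_⊎_; inj₁; inj₂)
open import Function using (_∘_; id; flip)
open import Function.Bundles using (_⇔_; mk⇔; Inverse)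
open import Function.Properties.Inverse using (Inverse⇒Injection)
open import Relation.Nullary using (¬_; Dec; yes; no; contradiction)
open import Relation.Nullary.Decidable
  using (map′; via-injection; decidable-stable; _×-dec_; _⊎-dec_; _→-dec_; ¬?)
import Relation.Unary as U
open import Relation.Binary.Core using (Rel)
open import Relation.Binary.Definitions using (Decidable; Reflexive; Transitive)
open import Relation.Binary.Structures using (IsEquivalence)
open import Relation.Binary.PropositionalEquality using (_≡_; _≢_; refl; sym; subst; subst₂)
open import Relation.Binary.Lattice.Bundles using (BoundedLattice)
open import Relation.Binary.Lattice.Structures using (IsBoundedLattice)
import Relation.Binary.Lattice.Properties.JoinSemilattice as JoinSemilatticeProperties
import Relation.Binary.Lattice.Properties.MeetSemilattice as MeetSemilatticeProperties

module _ {A : Set} {R : Rel A 0ℓ} (R? : Decidable R) (R-refl : Reflexive R) (R-trans : Transitive R)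
         {P : U.Pred A 0ℓ} (P? : U.Decidable P) where

  extendToMaximal : (l : List A) → ∀ {m} → P m →
                    ∃[ m′ ] (P m′ × R m m′ × (∀ {z} → z ∈ l → P z → R m′ z → R z m′))
  extendToMaximal [] {m} Pm = m , Pm , R-refl , λ ()
  extendToMaximal (z ∷ l) {m} Pm with P? z ×-dec R? m z
  ... | yes (Pz , mRz) =
    let m′ , Pm′ , zRm′ , maximal = extendToMaximal l Pz
    in m′ , Pm′ , R-trans mRz zRm′ , λ { (here refl) _ _ → zRm′ ; (there z∈l) → maximal z∈l }
  ... | no ¬[Pz×mRz] =
    let m′ , Pm′ , mRm′ , maximal = extendToMaximal l Pm
    in m′ , Pm′ , mRm′ ,
       λ { (here refl) Pz m′Rz → contradiction (Pz , R-trans mRm′ m′Rz) ¬[Pz×mRz]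
         ; (there z∈l) → maximal z∈l }

module FiniteLatticeProperties (𝓛 : FiniteLattice) where
  open FiniteLattice 𝓛
  open LatticeNotions 𝓛
  open IsBoundedLattice isBoundedLattice
    using (x≤x∨y; y≤x∨y; ∨-least; x∧y≤x; x∧y≤y; ∧-greatest; minimum; maximum)
    renaming (refl to ≤-refl; trans to ≤-trans; antisym to ≤-antisym; reflexive to ≤-reflexive)
  open Inverse enum using (to; from; strictlyInverseʳ)

  private
    boundedLattice : BoundedLattice 0ℓ 0ℓ 0ℓ
    boundedLattice = record { isBoundedLattice = isBoundedLattice }

  open JoinSemilatticeProperties (BoundedLattice.joinSemilattice boundedLattice)
    using (x≤y⇒x∨y≈y; ≈-dec⇒≤-dec)
  open MeetSemilatticeProperties (BoundedLattice.meetSemilattice boundedLattice)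
    using (y≤x⇒x∧y≈y)

  _≟_ : Decidable {A = Carrier} _≡_
  _≟_ = via-injection (Inverse⇒Injection enum) Fin._≟_

  _≤?_ : Decidable _≤_
  _≤?_ = ≈-dec⇒≤-dec _≟_

  all? : {P : U.Pred Carrier 0ℓ} → U.Decidable P → Dec (∀ x → P x)
  all? {P} P? = map′ (λ ∀P x → subst P (strictlyInverseʳ x) (∀P (to x)))
                     (λ ∀P i → ∀P (from i))
                     (Fin.all? (P? ∘ from))

  any? : {P : U.Pred Carrier 0ℓ} → U.Decidable P → Dec (∃[ x ] P x)
  any? {P} P? = map′ (λ (i , P[i]) → from i , P[i])
                     (λ (x , Px) → to x , subst P (sym (strictlyInverseʳ x)) Px)
                     (Fin.any? (P? ∘ from))

  _⋖?_ : Decidable _⋖_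
  u ⋖? v = ((u ≤? v) ×-dec ¬? (u ≟ v))
           ×-dec all? (λ z → (u ≤? z) →-dec (z ≤? v) →-dec ((z ≟ u) ⊎-dec (z ≟ v)))

  elements : List Carrier
  elements = map from (allFin size)

  ∈-elements : ∀ x → x ∈ elements
  ∈-elements x = subst (_∈ elements) (strictlyInverseʳ x) (∈-map⁺ from (∈-allFin (to x)))

  maximalAbove : {P : U.Pred Carrier 0ℓ} → U.Decidable P → ∀ {m} → P m →
                 ∃[ m′ ] (P m′ × m ≤ m′ × (∀ {z} → P z → m′ ≤ z → z ≡ m′))
  maximalAbove P? Pm =
    let m′ , Pm′ , m≤m′ , maximal = extendToMaximal _≤?_ ≤-refl ≤-trans P? elements Pm
    in m′ , Pm′ , m≤m′ , λ Pz m′≤z → ≤-antisym (maximal (∈-elements _) Pz m′≤z) m′≤z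

  minimalBelow : {P : U.Pred Carrier 0ℓ} → U.Decidable P → ∀ {m} → P m →
                 ∃[ m′ ] (P m′ × m′ ≤ m × (∀ {z} → P z → z ≤ m′ → z ≡ m′))
  minimalBelow P? Pm =
    let m′ , Pm′ , m′≤m , minimal =
          extendToMaximal (flip _≤?_) ≤-refl (flip ≤-trans) P? elements Pm
    in m′ , Pm′ , m′≤m , λ Pz z≤m′ → ≤-antisym z≤m′ (minimal (∈-elements _) Pz z≤m′)

  ⋖⇒≤ : ∀ {u v} → u ⋖ v → u ≤ v
  ⋖⇒≤ ((u≤v , _) , _) = u≤v

  ⋖⇒≱ : ∀ {u v} → u ⋖ v → ¬ v ≤ u
  ⋖⇒≱ ((u≤v , u≢v) , _) v≤u = u≢v (≤-antisym u≤v v≤u)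

  ⋖-≤⇒≢⊥ : ∀ {u v y} → u ⋖ v → v ≤ y → y ≢ ⊥
  ⋖-≤⇒≢⊥ {u} u⋖v v≤y refl = ⋖⇒≱ u⋖v (≤-trans v≤y (minimum u))

  lowerCoverAbove : ∀ {w x} → w ≤ x → w ≢ x → ∃[ u ] (w ≤ u × u ⋖ x)
  lowerCoverAbove {x = x} w≤x w≢x
    with maximalAbove (λ z → (z ≤? x) ×-dec ¬? (z ≟ x)) (w≤x , w≢x)
  ... | u , (u≤x , u≢x) , w≤u , maximal = u , w≤u , (u≤x , u≢x) , between
    where
    between : ∀ z → u ≤ z → z ≤ x → z ≡ u ⊎ z ≡ x
    between z u≤z z≤x with z ≟ x
    ... | yes z≡x = inj₂ z≡x
    ... | no z≢x = inj₁ (maximal (z≤x , z≢x) u≤z)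

  atomBelow : ∀ {z} → z ≢ ⊥ → ∃[ b ] (IsAtom b × b ≤ z)
  atomBelow {z} z≢⊥ with minimalBelow (λ w → ¬? (w ≟ ⊥) ×-dec (w ≤? z)) (z≢⊥ , ≤-refl)
  ... | b , (b≢⊥ , b≤z) , _ , minimal = b , ((minimum b , b≢⊥ ∘ sym) , between) , b≤z
    where
    between : ∀ w → ⊥ ≤ w → w ≤ b → w ≡ ⊥ ⊎ w ≡ b
    between w _ w≤b with w ≟ ⊥
    ... | yes w≡⊥ = inj₁ w≡⊥
    ... | no w≢⊥ = inj₂ (minimal (w≢⊥ , ≤-trans w≤b b≤z) w≤b)

  ≤atom⇒≡⊥⊎≡ : ∀ {a w} → IsAtom a → w ≤ a → w ≡ ⊥ ⊎ w ≡ a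
  ≤atom⇒≡⊥⊎≡ {w = w} (_ , between) w≤a = between w (minimum w) w≤a

  atom⇒joinIrreducible : ∀ {a} → IsAtom a → IsJoinIrreducible a
  atom⇒joinIrreducible {a} at = ⋖-≤⇒≢⊥ at ≤-refl , split
    where
    split : ∀ p q → p ∨ q ≡ a → p ≡ a ⊎ q ≡ a
    split p q p∨q≡a with ≤atom⇒≡⊥⊎≡ at (subst (p ≤_) p∨q≡a (x≤x∨y p q))
                       | ≤atom⇒≡⊥⊎≡ at (subst (q ≤_) p∨q≡a (y≤x∨y p q))
    ... | inj₂ p≡a | _ = inj₁ p≡a
    ... | inj₁ _ | inj₂ q≡a = inj₂ q≡a
    ... | inj₁ refl | inj₁ refl =
      contradiction (subst (_≤ ⊥) p∨q≡a (∨-least ≤-refl ≤-refl)) (⋖⇒≱ at)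

  atom-lowerCover≡⊥ : ∀ {a c} → IsAtom a → c ⋖ a → c ≡ ⊥
  atom-lowerCover≡⊥ at c⋖a with ≤atom⇒≡⊥⊎≡ at (⋖⇒≤ c⋖a)
  ... | inj₁ c≡⊥ = c≡⊥
  ... | inj₂ refl = contradiction ≤-refl (⋖⇒≱ c⋖a)

  SameRel-refl : ∀ {R} → SameRel R R
  SameRel-refl x y = id , id

  SameRel-sym : ∀ {R S} → SameRel R S → SameRel S R
  SameRel-sym R~S x y = let R⇒S , S⇒R = R~S x y in S⇒R , R⇒S

  SameRel-trans : ∀ {R S T} → SameRel R S → SameRel S T → SameRel R T
  SameRel-trans R~S S~T x y =
    let R⇒S , S⇒R = R~S x y
        S⇒T , T⇒S = S~T x y
    in S⇒T ∘ R⇒S , S⇒R ∘ T⇒S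

  -- [p,q] transposes up to [r,s]; congruences are closed under such transpositions.
  cg-transpose : ∀ {p q r s} → r ∧ q ≡ p → q ∨ r ≡ s → SameRel (cg p q) (cg r s)
  cg-transpose {p} {q} {r} {s} r∧q≡p q∨r≡s x y =
    (λ cg[p,q] θ θ-cong θrs → cg[p,q] θ θ-cong (down θ θ-cong θrs)) ,
    (λ cg[r,s] θ θ-cong θpq → cg[r,s] θ θ-cong (up θ θ-cong θpq))
    where
    p∨r≡r : p ∨ r ≡ r
    p∨r≡r = x≤y⇒x∨y≈y (subst (_≤ r) r∧q≡p (x∧y≤x r q))

    s∧q≡q : s ∧ q ≡ q
    s∧q≡q = y≤x⇒x∧y≈y (subst (q ≤_) q∨r≡s (x≤x∨y q r))

    up : ∀ θ → IsCongruence θ → θ p q → θ r s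
    up θ (θ-equiv , ∨-compat , _) θpq =
      subst₂ θ p∨r≡r q∨r≡s (∨-compat p q r r θpq (IsEquivalence.refl θ-equiv))

    down : ∀ θ → IsCongruence θ → θ r s → θ p q
    down θ (θ-equiv , _ , ∧-compat) θrs =
      subst₂ θ r∧q≡p s∧q≡q (∧-compat r s q q θrs (IsEquivalence.refl θ-equiv))

  cg-atom≡cg-cover : ∀ {a u x} → IsAtom a → u ⋖ x → a ≤ x → ¬ a ≤ u →
                     SameRel (cg ⊥ a) (cg u x)
  cg-atom≡cg-cover {a} {u} {x} at u⋖x@((u≤x , _) , between) a≤x a≰u =
    cg-transpose u∧a≡⊥ a∨u≡x
    where
    u∧a≡⊥ : u ∧ a ≡ ⊥
    u∧a≡⊥ with ≤atom⇒≡⊥⊎≡ at (x∧y≤y u a)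
    ... | inj₁ u∧a≡⊥ = u∧a≡⊥
    ... | inj₂ u∧a≡a = contradiction (subst (_≤ u) u∧a≡a (x∧y≤x u a)) a≰u

    a∨u≡x : a ∨ u ≡ x
    a∨u≡x with between (a ∨ u) (y≤x∨y a u) (∨-least a≤x u≤x)
    ... | inj₁ a∨u≡u = contradiction (subst (a ≤_) a∨u≡u (x≤x∨y a u)) a≰u
    ... | inj₂ a∨u≡x = a∨u≡x

  record SeparatingMeetIrreducible (p q z : Carrier) : Set₁ where
    field
      m : Carrier
      z≤m : z ≤ m
      q≰m : ¬ q ≤ m
      meetIrreducible : IsMeetIrreducible m
      m⋖q∨m : m ⋖ (q ∨ m)
      cg-m≡cg-pq : SameRel (cg m (q ∨ m)) (cg p q)

  separatingMeetIrreducible : ∀ {p q z} → p ⋖ q → p ≤ z → ¬ q ≤ z →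
                              SeparatingMeetIrreducible p q z
  separatingMeetIrreducible {p} {q} {z} p⋖q@(_ , p-q-between) p≤z q≰z
    with maximalAbove (λ w → (p ≤? w) ×-dec ¬? (q ≤? w)) (p≤z , q≰z)
  ... | m , (p≤m , q≰m) , z≤m , maximal = record
    { m = m
    ; z≤m = z≤m
    ; q≰m = q≰m
    ; meetIrreducible = (λ m≡⊤ → q≰m (subst (q ≤_) (sym m≡⊤) (maximum q))) , split
    ; m⋖q∨m = (y≤x∨y q m , λ m≡q∨m → q≰m (subst (q ≤_) (sym m≡q∨m) (x≤x∨y q m))) , between
    ; cg-m≡cg-pq = SameRel-sym (cg-transpose m∧q≡p refl)
    }
    where
    ≱q⇒≡m : ∀ {w} → m ≤ w → ¬ q ≤ w → w ≡ m
    ≱q⇒≡m m≤w q≰w = maximal (≤-trans p≤m m≤w , q≰w) m≤w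

    split : ∀ a b → a ∧ b ≡ m → a ≡ m ⊎ b ≡ m
    split a b a∧b≡m with q ≤? a | q ≤? b
    ... | no q≰a | _ = inj₁ (≱q⇒≡m (subst (_≤ a) a∧b≡m (x∧y≤x a b)) q≰a)
    ... | yes _ | no q≰b = inj₂ (≱q⇒≡m (subst (_≤ b) a∧b≡m (x∧y≤y a b)) q≰b)
    ... | yes q≤a | yes q≤b = contradiction (subst (q ≤_) a∧b≡m (∧-greatest q≤a q≤b)) q≰m

    between : ∀ w → m ≤ w → w ≤ (q ∨ m) → w ≡ m ⊎ w ≡ (q ∨ m)
    between w m≤w w≤q∨m with q ≤? w
    ... | yes q≤w = inj₂ (≤-antisym w≤q∨m (∨-least q≤w m≤w))
    ... | no q≰w = inj₁ (≱q⇒≡m m≤w q≰w)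

    m∧q≡p : m ∧ q ≡ p
    m∧q≡p with p-q-between (m ∧ q) (∧-greatest p≤m (⋖⇒≤ p⋖q)) (x∧y≤y m q)
    ... | inj₁ m∧q≡p = m∧q≡p
    ... | inj₂ m∧q≡q = contradiction (subst (_≤ m) m∧q≡q (x∧y≤x m q)) q≰m

  joinand≰allLowerCovers : ∀ {A x a} → IsIrredundantJoinRep A x → A a →
                           ¬ (∀ u → u ⋖ x → a ≤ u)
  joinand≰allLowerCovers {A} {x} {a} ((ub , least) , irredundant) Aa a≤covers =
    irredundant A∖a (λ _ → proj₁) (a , Aa , λ (_ , a≢a) → a≢a refl) (ub∖a , least∖a)
    where
    A∖a : Subset
    A∖a b = A b × b ≢ a

    ub∖a : ∀ b → A∖a b → b ≤ x
    ub∖a b (Ab , _) = ub b Ab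

    -- An upper bound z of A∖a with x ≰ z yields a lower cover u ≥ x ∧ z of x; then
    -- all of A, a included, lies below u, so x ≤ u.
    least∖a : ∀ z → (∀ b → A∖a b → b ≤ z) → x ≤ z
    least∖a z z-ub with (x ∧ z) ≟ x
    ... | yes x∧z≡x = subst (_≤ z) x∧z≡x (x∧y≤y x z)
    ... | no x∧z≢x with lowerCoverAbove (x∧y≤x x z) x∧z≢x
    ...   | u , x∧z≤u , u⋖x = contradiction (least u A≤u) (⋖⇒≱ u⋖x)
      where
      A≤u : ∀ b → A b → b ≤ u
      A≤u b Ab with b ≟ a
      ... | yes refl = a≤covers u u⋖x
      ... | no b≢a = ≤-trans (∧-greatest (ub b Ab) (z-ub b (Ab , b≢a))) x∧z≤u

  lowerCoverAvoidingJoinand : ∀ {A x a} → IsIrredundantJoinRep A x → A a →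
                              ∃[ u ] (u ⋖ x × ¬ a ≤ u)
  lowerCoverAvoidingJoinand {x = x} {a} rep Aa with any? (λ u → (u ⋖? x) ×-dec ¬? (a ≤? u))
  ... | yes found = found
  ... | no none = contradiction
    (λ u u⋖x → decidable-stable (a ≤? u) (λ a≰u → none (u , u⋖x , a≰u)))
    (joinand≰allLowerCovers rep Aa)

  module CongruenceUniformLattice (CU : CongruenceUniform) where
    open SeparatingMeetIrreducible

    separating-unique : ∀ {p q z p′ q′ z′} → SameRel (cg p q) (cg p′ q′) →
                        (S : SeparatingMeetIrreducible p q z)
                        (S′ : SeparatingMeetIrreducible p′ q′ z′) → m S ≡ m S′
    separating-unique pq~p′q′ S S′ =
      proj₂ CU _ _ _ _ (meetIrreducible S) (meetIrreducible S′) (m⋖q∨m S) (m⋖q∨m S′)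
        (SameRel-trans (cg-m≡cg-pq S) (SameRel-trans pq~p′q′ (SameRel-sym (cg-m≡cg-pq S′))))

    κ-separating : ∀ {a} → IsAtom a → SeparatingMeetIrreducible ⊥ a ⊥
    κ-separating at = separatingMeetIrreducible at ≤-refl (⋖⇒≱ at)

    κ : ∀ {a} → IsAtom a → Carrier
    κ at = m (κ-separating at)

    atom≰κ : ∀ {a} (at : IsAtom a) → ¬ a ≤ κ at
    atom≰κ at = q≰m (κ-separating at)

    ≱atom⇒≤κ : ∀ {a z} (at : IsAtom a) → ¬ a ≤ z → z ≤ κ at
    ≱atom⇒≤κ {z = z} at a≰z = subst (z ≤_) (separating-unique SameRel-refl S (κ-separating at)) (z≤m S)
      where S = separatingMeetIrreducible at (minimum z) a≰z

    atomLabel⇒atom≤ : ∀ {a u v} → IsAtom a → u ⋖ v → SameRel (cg ⊥ a) (cg u v) → a ≤ v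
    atomLabel⇒atom≤ {a} {u} {v} at u⋖v a~uv with a ≤? v
    ... | yes a≤v = a≤v
    ... | no a≰v = contradiction (subst (v ≤_) (separating-unique a~uv S S′) (z≤m S)) (q≰m S′)
      where
      S = separatingMeetIrreducible at (minimum v) a≰v
      S′ = separatingMeetIrreducible u⋖v ≤-refl (⋖⇒≱ u⋖v)

    atom≤joinOfAtoms⇒¬¬∈ : ∀ {A x b} → (∀ a → A a → IsAtom a) → IsJoinOf A x →
                           IsAtom b → b ≤ x → ¬ ¬ A b
    atom≤joinOfAtoms⇒¬¬∈ {A} {b = b} atoms (_ , least) atb b≤x b∉A =
      atom≰κ atb (≤-trans b≤x (least (κ atb) λ a Aa → ≱atom⇒≤κ atb (b≰ Aa)))
      where
      b≰ : ∀ {a} → A a → ¬ b ≤ a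
      b≰ {a} Aa b≤a with ≤atom⇒≡⊥⊎≡ (atoms a Aa) b≤a
      ... | inj₁ b≡⊥ = ⋖-≤⇒≢⊥ atb ≤-refl b≡⊥
      ... | inj₂ refl = b∉A Aa

    atomicJoin⇒nucleus≡⊥ : ∀ {A y} → IsIrredundantJoinRep A y → (∀ a → A a → IsAtom a) →
                           y ≢ ⊥ → IsNucleus y ⊥
    atomicJoin⇒nucleus≡⊥ {A} {y} rep@(join , _) atoms y≢⊥ = (λ w _ → minimum w) , ≤covers⇒≤⊥
      where
      ≤covers⇒≤⊥ : ∀ z → (∀ w → w ⋖ y → z ≤ w) → z ≤ ⊥
      ≤covers⇒≤⊥ z z≤covers with z ≟ ⊥
      ... | yes z≡⊥ = ≤-reflexive z≡⊥
      ... | no z≢⊥ with atomBelow z≢⊥ | lowerCoverAbove (minimum y) (y≢⊥ ∘ sym)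
      ...   | b , atb , b≤z | u , _ , u⋖y =
        contradiction (λ Ab → joinand≰allLowerCovers rep Ab (λ w w⋖y → ≤-trans b≤z (z≤covers w w⋖y)))
                      (atom≤joinOfAtoms⇒¬¬∈ atoms join atb b≤y)
        where
        b≤y : b ≤ y
        b≤y = ≤-trans b≤z (≤-trans (z≤covers u u⋖y) (⋖⇒≤ u⋖y))

    joinand∈Ψ : ∀ {A x a} → IsIrredundantJoinRep A x → (∀ a → A a → IsAtom a) → A a → a ∈Ψ x
    joinand∈Ψ {x = x} {a} rep@((ub , _) , _) atoms Aa with lowerCoverAvoidingJoinand rep Aa
    ... | u , u⋖x , a≰u =
      atom⇒joinIrreducible at , ⊥ , at , u , x , ⊥ ,
      atomicJoin⇒nucleus≡⊥ rep atoms (⋖-≤⇒≢⊥ at a≤x) , minimum u , u⋖x , ≤-refl ,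
      cg-atom≡cg-cover at u⋖x a≤x a≰u
      where
      at = atoms a Aa
      a≤x = ub a Aa

    atom∈Ψ⇒≤ : ∀ {a y} → IsAtom a → a ∈Ψ y → a ≤ y
    atom∈Ψ⇒≤ at (_ , c , c⋖a , u , v , _ , _ , _ , u⋖v , v≤y , a~uv)
      with atom-lowerCover≡⊥ at c⋖a
    ... | refl = ≤-trans (atomLabel⇒atom≤ at u⋖v a~uv) v≤y

    ≤⇒⊆Ψ : ∀ {A x y} → IsIrredundantJoinRep A y → (∀ a → A a → IsAtom a) → x ≤ y → x ⊆Ψ y
    ≤⇒⊆Ψ rep atoms x≤y j (jJI , c , c⋖j , u , v , _ , _ , _ , u⋖v , v≤x , j~uv) =
      jJI , c , c⋖j , u , v , ⊥ , atomicJoin⇒nucleus≡⊥ rep atoms (⋖-≤⇒≢⊥ u⋖v v≤y) ,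
      minimum u , u⋖v , v≤y , j~uv
      where v≤y = ≤-trans v≤x x≤y

    ⊆Ψ⇒≤ : ∀ {A x y} → IsIrredundantJoinRep A x → (∀ a → A a → IsAtom a) → x ⊆Ψ y → x ≤ y
    ⊆Ψ⇒≤ rep@((_ , least) , _) atoms x⊆y =
      least _ λ a Aa → atom∈Ψ⇒≤ (atoms a Aa) (x⊆y a (joinand∈Ψ rep atoms Aa))

proposition5p6 : (𝓛 : FiniteLattice) → LatticeNotions.CongruenceUniform 𝓛
    → ∀ x y → LatticeNotions.InNex 𝓛 x → LatticeNotions.InNex 𝓛 y
    → (FiniteLattice._≤_ 𝓛 x y ⇔ LatticeNotions._⊆Ψ_ 𝓛 x y)
proposition5p6 𝓛 CU x y (_ , (repˣ , _) , atomsˣ) (_ , (repʸ , _) , atomsʸ) =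
  mk⇔ (≤⇒⊆Ψ repʸ atomsʸ) (⊆Ψ⇒≤ repˣ atomsˣ)
  where open FiniteLatticeProperties.CongruenceUniformLattice 𝓛 CU
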